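{- Let $(X,\mathcal{T},(I_i)_{i\in\mathbb{N}})$ be a computable topological space and let $S$ be a locally c.e. set in $(X,\mathcal{T},(I_i))$ such that $S$ is compact in $(X,\mathcal{T})$. Then $S$ is c.e. in $(X,\mathcal{T},(I_i))$.
   Context: A computable topological space is a triple $(X,\mathcal{T},(I_i))$ with $(X,\mathcal{T})$ a topological space, $\{I_i\}\subseteq\mathcal{T}$ a basis, and c.e. sets $\mathcal{C},\mathcal{D}\subseteq\mathbb{N}^2$ such that: (1) $(i,j)\in\mathcal{D}\Rightarrow I_i\cap I_j=\emptyset$; (2) $(i,j)\in\mathcal{C}\Rightarrow I_i\subseteq I_j$; (3) for $x\neq y$ there are $i,j$ with $x\in I_i$, $y\in I_j$, $(i,j)\in\mathcal{D}$; (4) if $x\in I_i\cap I_j$ there is $k$ with $x\in I_k$, $(k,i),(k,j)\in\mathcal{C}$. A closed set $S$ is c.e. if $\{i: I_i\cap S\neq\emptyset\}$ is c.e. For $A\subseteq S\subseteq X$, $A$ is c.e. up to $S$ if there is a c.e. $\Omega\subseteq\mathbb{N}$ with $I_i\cap A\neq\emptyset\Rightarrow i\in\Omega$ and $i\in\Omega\Rightarrow I_i\cap S\neq\emptyset$ for all $i$. $S$ is c.e. at $x\in S$ if some neighborhood of $x$ in $S$ is c.e. up to $S$; $S$ is locally c.e. if it is c.e. at each of its points. -}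

module Defs where

open import Data.Nat using (ℕ; zero; suc)
open import Data.Fin using (Fin)
open import Data.Vec using (Vec; []; _∷_; lookup)
open import Data.Product using (Σ; ∃; ∃-syntax; _×_; _,_)
open import Data.List using (List)
open import Data.List.Relation.Unary.Any using (Any)
open import Data.Empty using (⊥)
open import Relation.Nullary using (¬_)
open import Relation.Binary.PropositionalEquality using (_≡_)

data PR : ℕ → Set where
  pzero : ∀ {n} → PR n
  psucc : PR 1
  pproj : ∀ {n} → Fin n → PR n
  pcomp : ∀ {m n} → PR m → Vec (PR n) m → PR n
  prec  : ∀ {n} → PR n → PR (suc (suc n)) → PR (suc n)

mutual
  eval : ∀ {n} → PR n → Vec ℕ n → ℕ
  eval pzero        xs = 0
  eval psucc        (x ∷ []) = suc x
  eval (pproj i)    xs = lookup xs i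
  eval (pcomp f gs) xs = eval f (evalAll gs xs)
  eval (prec f g)   (zero ∷ xs)  = eval f xs
  eval (prec f g)   (suc k ∷ xs) = eval g (k ∷ eval (prec f g) (k ∷ xs) ∷ xs)

  evalAll : ∀ {m n} → Vec (PR n) m → Vec ℕ n → Vec ℕ m
  evalAll []       xs = []
  evalAll (g ∷ gs) xs = eval g xs ∷ evalAll gs xs

-- A set of naturals is c.e. iff it is the projection of a primitive
-- recursive relation (Kleene normal form): n ∈ P ⇔ ∃ m. f(n,m) = 0.
CE : (ℕ → Set) → Set
CE P = Σ (PR 2) λ f → ∀ n → (P n → ∃[ m ] eval f (n ∷ m ∷ []) ≡ 0)
                          × ((∃[ m ] eval f (n ∷ m ∷ []) ≡ 0) → P n)

CE₂ : (ℕ → ℕ → Set) → Set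
CE₂ P = Σ (PR 3) λ f → ∀ i j → (P i j → ∃[ m ] eval f (i ∷ j ∷ m ∷ []) ≡ 0)
                              × ((∃[ m ] eval f (i ∷ j ∷ m ∷ []) ≡ 0) → P i j)

Subset : Set → Set₁
Subset X = X → Set

_⊆_ : {X : Set} → Subset X → Subset X → Set
A ⊆ B = ∀ x → A x → B x

_∩_ : {X : Set} → Subset X → Subset X → Subset X
(A ∩ B) x = A x × B x

-- "A ∩ B ≠ ∅", read as: A and B have a common point
Meets : {X : Set} → Subset X → Subset X → Set
Meets A B = ∃[ x ] (A x × B x)

⋃ : {X J : Set} → (J → Subset X) → Subset X
⋃ U x = ∃[ j ] U j x

record ComputableTopSpace : Set₁ where
  field
    X      : Set
    Open   : Subset X → Set
    open-univ  : Open (λ _ → X)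
    open-⋃     : (J : Set) (U : J → Subset X) → (∀ j → Open (U j)) → Open (⋃ U)
    open-∩     : ∀ U V → Open U → Open V → Open (U ∩ V)
    I          : ℕ → Subset X
    I-open     : ∀ i → Open (I i)
    I-basis    : ∀ U x → Open U → U x → ∃[ i ] (I i x × I i ⊆ U)
    𝒞 𝒟       : ℕ → ℕ → Set
    𝒞-ce       : CE₂ 𝒞
    𝒟-ce       : CE₂ 𝒟
    cond1      : ∀ i j → 𝒟 i j → ¬ Meets (I i) (I j)
    cond2      : ∀ i j → 𝒞 i j → I i ⊆ I j
    cond3      : ∀ x y → ¬ x ≡ y → ∃[ i ] ∃[ j ] (I i x × I j y × 𝒟 i j)
    cond4      : ∀ x i j → I i x → I j x → ∃[ k ] (I k x × 𝒞 k i × 𝒞 k j)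

module _ (𝕏 : ComputableTopSpace) where
  open ComputableTopSpace 𝕏

  IsCE : Subset X → Set
  IsCE S = CE (λ i → Meets (I i) S)

  CEUpTo : Subset X → Subset X → Set₁
  CEUpTo A S = Σ (ℕ → Set) λ Ω → CE Ω
    × (∀ i → Meets (I i) A → Ω i)
    × (∀ i → Ω i → Meets (I i) S)

  NbhdIn : Subset X → X → Subset X → Set₁
  NbhdIn S x N = N ⊆ S × Σ (Subset X) λ U → Open U × U x × ((U ∩ S) ⊆ N)

  CEAt : Subset X → X → Set₁
  CEAt S x = Σ (Subset X) λ N → NbhdIn S x N × CEUpTo N S

  LocallyCE : Subset X → Set₁
  LocallyCE S = ∀ x → S x → CEAt S x

  Compact : Subset X → Set₁
  Compact S = (J : Set) (U : J → Subset X) → (∀ j → Open (U j))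
    → (∀ x → S x → ∃[ j ] U j x)
    → Σ (List J) λ js → (∀ x → S x → Any {A = J} (λ j → U j x) js)

-- Compactness turns the local witnesses into finitely many: the neighbourhoods
-- N_x of points x ∈ S witnessing local c.e.-ness contain relatively open sets
-- U_x ∩ S, finitely many of which cover S. If Ω_x is c.e. up to S for N_x,
-- then {i | I i ∩ S ≠ ∅} is exactly the finite union of these Ω_x, and
-- c.e. sets are closed under finite unions.
module Submission where

open import Defs
open import Data.Nat using (ℕ; zero; suc; _+_; _*_)
open import Data.Nat.Properties using (+-comm; *-zeroʳ; m*n≡0⇒m≡0∨n≡0)
open import Data.Fin using () renaming (zero to fz; suc to fs)
open import Data.Vec using ([]; _∷_)
open import Data.Product using (Σ; ∃-syntax; _,_; proj₁; proj₂)
open import Data.Sum using (_⊎_; inj₁; inj₂)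
open import Data.List using (List; []; _∷_)
open import Data.List.Relation.Unary.Any using (Any; here; there)
import Data.List.Relation.Unary.Any as Any
open import Data.Empty using (⊥)
open import Relation.Binary.PropositionalEquality using (_≡_; refl; sym; trans; cong)
open Relation.Binary.PropositionalEquality.≡-Reasoning

addPR : PR 2
addPR = prec (pproj fz) (pcomp psucc (pproj (fs fz) ∷ []))

eval-addPR : ∀ a b → eval addPR (a ∷ b ∷ []) ≡ a + b
eval-addPR zero    b = refl
eval-addPR (suc a) b = cong suc (eval-addPR a b)

mulPR : PR 2
mulPR = prec pzero (pcomp addPR (pproj (fs fz) ∷ pproj (fs (fs fz)) ∷ []))

eval-mulPR : ∀ a b → eval mulPR (a ∷ b ∷ []) ≡ a * b
eval-mulPR zero    b = refl
eval-mulPR (suc a) b = begin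
  eval addPR (eval mulPR (a ∷ b ∷ []) ∷ b ∷ []) ≡⟨ eval-addPR _ b ⟩
  eval mulPR (a ∷ b ∷ []) + b                   ≡⟨ cong (_+ b) (eval-mulPR a b) ⟩
  a * b + b                                     ≡⟨ +-comm (a * b) b ⟩
  b + a * b                                     ∎

CE-cong : ∀ {P Q : ℕ → Set} → (∀ n → P n → Q n) → (∀ n → Q n → P n) → CE P → CE Q
CE-cong P⇒Q Q⇒P (f , f-ok) =
  f , λ n → (λ q → proj₁ (f-ok n) (Q⇒P n q)) , (λ w → P⇒Q n (proj₂ (f-ok n) w))

CE-∅ : CE (λ _ → ⊥)
CE-∅ = pcomp psucc (pzero ∷ []) , λ n → (λ ()) , λ { (_ , ()) }

-- The product f·g vanishes exactly where f or g does.
CE-∪ : ∀ {P Q : ℕ → Set} → CE P → CE Q → CE (λ n → P n ⊎ Q n)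
CE-∪ {P} {Q} (f , f-ok) (g , g-ok) = fg , λ n → complete n , sound n
  where
  fg : PR 2
  fg = pcomp mulPR (f ∷ g ∷ [])
  F G : ℕ → ℕ → ℕ
  F n m = eval f (n ∷ m ∷ [])
  G n m = eval g (n ∷ m ∷ [])

  eval-fg : ∀ n m → eval fg (n ∷ m ∷ []) ≡ F n m * G n m
  eval-fg n m = eval-mulPR (F n m) (G n m)

  complete : ∀ n → P n ⊎ Q n → ∃[ m ] eval fg (n ∷ m ∷ []) ≡ 0
  complete n (inj₁ p) with proj₁ (f-ok n) p
  ... | m , Fm≡0 = m , (begin
    eval fg (n ∷ m ∷ []) ≡⟨ eval-fg n m ⟩
    F n m * G n m        ≡⟨ cong (_* G n m) Fm≡0 ⟩
    0                    ∎)
  complete n (inj₂ q) with proj₁ (g-ok n) q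
  ... | m , Gm≡0 = m , (begin
    eval fg (n ∷ m ∷ []) ≡⟨ eval-fg n m ⟩
    F n m * G n m        ≡⟨ cong (F n m *_) Gm≡0 ⟩
    F n m * 0            ≡⟨ *-zeroʳ (F n m) ⟩
    0                    ∎)

  sound : ∀ n → ∃[ m ] eval fg (n ∷ m ∷ []) ≡ 0 → P n ⊎ Q n
  sound n (m , fg≡0) with m*n≡0⇒m≡0∨n≡0 (F n m) (trans (sym (eval-fg n m)) fg≡0)
  ... | inj₁ Fm≡0 = inj₁ (proj₂ (f-ok n) (m , Fm≡0))
  ... | inj₂ Gm≡0 = inj₂ (proj₂ (g-ok n) (m , Gm≡0))

CE-Any : ∀ {J : Set} (Ω : J → ℕ → Set) → (∀ j → CE (Ω j)) → (js : List J)
       → CE (λ n → Any (λ j → Ω j n) js)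
CE-Any Ω Ω-ce []       = CE-cong (λ _ ()) (λ _ ()) CE-∅
CE-Any Ω Ω-ce (j ∷ js) =
  CE-cong (λ _ → λ { (inj₁ p) → here p ; (inj₂ q) → there q })
          (λ _ → λ { (here p) → inj₁ p ; (there q) → inj₂ q })
          (CE-∪ (Ω-ce j) (CE-Any Ω Ω-ce js))

module _ (𝕏 : ComputableTopSpace) where
  open ComputableTopSpace 𝕏

  Compact⇒finiteNbhdSubcover : {S : Subset X} → Compact 𝕏 S
    → (N : Σ X S → Subset X) → (∀ p → NbhdIn 𝕏 S (proj₁ p) (N p))
    → Σ (List (Σ X S)) λ ps → ∀ y → S y → Any (λ p → N p y) ps
  Compact⇒finiteNbhdSubcover {S} compact N N-nbhd =
    let ps , U-cover = compact (Σ X S) U U-open U-covers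
    in  ps , λ y Sy → Any.map (λ {p} Upy → U∩S⊆N p y (Upy , Sy)) (U-cover y Sy)
    where
    U : Σ X S → Subset X
    U p = proj₁ (proj₂ (N-nbhd p))
    U∩S⊆N : ∀ p → (U p ∩ S) ⊆ N p
    U∩S⊆N p = proj₂ (proj₂ (proj₂ (proj₂ (N-nbhd p))))
    U-open : ∀ p → Open (U p)
    U-open p = proj₁ (proj₂ (proj₂ (N-nbhd p)))
    U-covers : ∀ x → S x → ∃[ p ] U p x
    U-covers x Sx = (x , Sx) , proj₁ (proj₂ (proj₂ (proj₂ (N-nbhd (x , Sx)))))

  IsCE-finiteCEUpToCover : {J : Set} {S : Subset X} (A : J → Subset X) (js : List J)
    → (∀ j → CEUpTo 𝕏 (A j) S) → (∀ y → S y → Any (λ j → A j y) js) → IsCE 𝕏 S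
  IsCE-finiteCEUpToCover {J} {S} A js A-ce cover =
    CE-cong sound complete (CE-Any Ω (λ j → proj₁ (proj₂ (A-ce j))) js)
    where
    Ω : J → ℕ → Set
    Ω j = proj₁ (A-ce j)

    sound : ∀ i → Any (λ j → Ω j i) js → Meets (I i) S
    sound i Ωi with Any.satisfied Ωi
    ... | j , Ωji = proj₂ (proj₂ (proj₂ (A-ce j))) i Ωji

    complete : ∀ i → Meets (I i) S → Any (λ j → Ω j i) js
    complete i (y , Iiy , Sy) =
      Any.map (λ {j} Ajy → proj₁ (proj₂ (proj₂ (A-ce j))) i (y , Iiy , Ajy)) (cover y Sy)

proposition5p2 : (𝕏 : ComputableTopSpace) (S : ComputableTopSpace.X 𝕏 → Set) → LocallyCE 𝕏 S → Compact 𝕏 S → IsCE 𝕏 S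
proposition5p2 𝕏 S locallyCE compact =
  let ps , cover = Compact⇒finiteNbhdSubcover 𝕏 compact N (λ p → proj₁ (proj₂ (witness p)))
  in  IsCE-finiteCEUpToCover 𝕏 N ps (λ p → proj₂ (proj₂ (witness p))) cover
  where
  witness : (p : Σ _ S) → CEAt 𝕏 S (proj₁ p)
  witness (x , Sx) = locallyCE x Sx
  N : Σ _ S → ComputableTopSpace.X 𝕏 → Set
  N p = proj₁ (witness p)
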